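{- Let $G$ be a finite simple graph of order $n$ with minimum degree $\delta=\delta(G)\geq 3$. Then $$\gamma_{st}(G)\leq n-2\left\lfloor\frac{2\rho_{o}(G)+\delta-3}{2}\right\rfloor,$$ and this bound is sharp, i.e., there are graphs satisfying the hypotheses for which equality holds.
   Context: For a vertex $v$, $N(v)$ denotes its open neighborhood. A signed total dominating function (STDF) of $G=(V,E)$ is a function $f:V\to\{ -1,1\}$ with $f(N(v))=\sum_{u\in N(v)}f(u)\geq 1$ for every $v\in V$; the signed total domination number $\gamma_{st}(G)$ is the minimum of $f(V)=\sum_{v\in V}f(v)$ over all STDFs $f$ of $G$. A set $B\subseteq V$ is an open packing if $N(u)\cap N(v)=\emptyset$ for all distinct $u,v\in B$; the open packing number $\rho_o(G)$ is the maximum cardinality of an open packing in $G$. -}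

module Defs where

open import Data.Nat as ℕ using (ℕ; _∸_)
open import Data.Nat.DivMod using (_/_)
open import Data.Integer as ℤ using (ℤ; +_; -_)
open import Data.Bool using (Bool; true; false; if_then_else_)
open import Data.Fin using (Fin)
open import Data.List using (List; foldr; map; allFin)
open import Data.Product using (Σ; _×_; ∃)
open import Relation.Binary.PropositionalEquality using (_≡_; _≢_)
open import Relation.Nullary using (¬_)

record SimpleGraph (n : ℕ) : Set where
  field
    adj    : Fin n → Fin n → Bool
    sym    : ∀ u v → adj u v ≡ adj v u
    irrefl : ∀ v → adj v v ≡ false
open SimpleGraph public

ΣℕV : ∀ {n} → (Fin n → ℕ) → ℕ
ΣℕV {n} g = foldr ℕ._+_ 0 (map g (allFin n))

ΣℤV : ∀ {n} → (Fin n → ℤ) → ℤ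
ΣℤV {n} g = foldr ℤ._+_ (+ 0) (map g (allFin n))

deg : ∀ {n} → SimpleGraph n → Fin n → ℕ
deg G v = ΣℕV (λ u → if adj G v u then 1 else 0)

IsMinDegree : ∀ {n} → SimpleGraph n → ℕ → Set
IsMinDegree G d = (∀ v → d ℕ.≤ deg G v) × ∃ (λ v → deg G v ≡ d)

-- functions V → {-1,1}, encoded by Bool (true ↦ 1, false ↦ -1)
sgn : Bool → ℤ
sgn true  = + 1
sgn false = - (+ 1)

fN : ∀ {n} → SimpleGraph n → (Fin n → Bool) → Fin n → ℤ
fN G f v = ΣℤV (λ u → if adj G v u then sgn (f u) else + 0)

weight : ∀ {n} → (Fin n → Bool) → ℤ
weight f = ΣℤV (λ u → sgn (f u))

IsSTDF : ∀ {n} → SimpleGraph n → (Fin n → Bool) → Set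
IsSTDF G f = ∀ v → + 1 ℤ.≤ fN G f v

IsSignedTotalDominationNumber : ∀ {n} → SimpleGraph n → ℤ → Set
IsSignedTotalDominationNumber G g =
  Σ (Fin _ → Bool) (λ f → IsSTDF G f × weight f ≡ g) ×
  (∀ f → IsSTDF G f → g ℤ.≤ weight f)

IsOpenPacking : ∀ {n} → SimpleGraph n → (Fin n → Bool) → Set
IsOpenPacking G B = ∀ u v → B u ≡ true → B v ≡ true → u ≢ v →
  ∀ w → ¬ (adj G u w ≡ true × adj G v w ≡ true)

card : ∀ {n} → (Fin n → Bool) → ℕ
card B = ΣℕV (λ u → if B u then 1 else 0)

IsOpenPackingNumber : ∀ {n} → SimpleGraph n → ℕ → Set
IsOpenPackingNumber G p =
  Σ (Fin _ → Bool) (λ B → IsOpenPacking G B × card B ≡ p) ×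
  (∀ B → IsOpenPacking G B → card B ℕ.≤ p)

-- n - 2 ⌊(2ρ + δ - 3)/2⌋  (for δ ≥ 3 the numerator is a natural number)
stBound : ℕ → ℕ → ℕ → ℤ
stBound n ρ δ = + n ℤ.- + (2 ℕ.* ((2 ℕ.* ρ ℕ.+ δ ∸ 3) / 2))

-- Let s = ⌊(δ − 3)/2⌋, so 2(s + 1) + 1 ≤ δ and
-- ⌊(2ρ_o + δ − 3)/2⌋ = ρ_o + s.  Take a maximum open packing B; every vertex
-- has at most one neighbour in B, so some set S of s vertices avoids B.
-- Label B ∪ S by −1 and all other vertices by +1.  Every open neighbourhood
-- then contains at most s + 1 vertices labelled −1 out of at least δ, hence
-- is positive: the labelling is an STDF of weight n − 2(ρ_o + s).
--
-- If all degrees are at most 4, then N(v) contains at most one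
-- −1 of any STDF, so the −1's form an open packing and every STDF has
-- weight at least n − 2ρ_o.  For K₄ (δ = 3, ρ_o = 1) this meets the bound.
module Submission where

open import Defs
open import Data.Nat using (ℕ; _≤_)
open import Data.Integer using (ℤ) renaming (_≤_ to _≤ℤ_)
open import Data.Product using (_×_; Σ; ∃)
open import Relation.Binary.PropositionalEquality using (_≡_)

open import Data.Nat using (zero; suc; _+_; _*_; _∸_; z≤n; s≤s; _<_)
import Data.Nat.Properties as NP
open import Data.Nat.DivMod using (_/_; m/n*n≤m; +-distrib-/-∣ˡ; m*n/n≡m; /-congˡ)
open import Data.Nat.Divisibility using (divides)
import Data.Integer as Z
open Z using (+_; -_) renaming (_+_ to _+ℤ_; _-_ to _-ℤ_)
import Data.Integer.Properties as ZP
open import Data.Integer.Solver using (module +-*-Solver)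
open import Data.Nat.Solver using () renaming (module +-*-Solver to NS)
open import Data.Bool using (Bool; true; false; if_then_else_; _∧_; _∨_; not)
import Data.Bool as Bool
open import Data.Bool.Properties using (not-involutive)
open import Data.Fin using (Fin; zero; suc)
open import Data.Fin.Properties using (_≟_; suc-injective; all?; any?)
import Data.List as List
import Data.Vec.Functional as Vector
open import Data.Product using (_,_; proj₁; proj₂)
open import Data.Empty using (⊥-elim)
open import Function using (_∘_; id)
open import Relation.Binary.PropositionalEquality
  using (refl; trans; cong; cong₂; subst; _≗_; module ≡-Reasoning)
  renaming (sym to ≡-sym)
open import Relation.Nullary using (yes; no; does)
open import Relation.Nullary.Decidable using (dec-true; does-⇔; toWitness; _×-dec_)
open import Function.Bundles using (mk⇔)
open import Algebra.Properties.CommutativeMonoid.Sum NP.+-0-commutativeMonoid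
  using (sum; ∑-distrib-+; sum-cong-≗)

-- Folding the list of all vertices is folding the vector over Fin n; the
-- latter recurses on n, so all sums below are computed by it.
foldr-map-tabulate : ∀ {A B : Set} {n} (_∙_ : B → B → B) (e : B) (g : A → B) (h : Fin n → A) →
  List.foldr _∙_ e (List.map g (List.tabulate h)) ≡ Vector.foldr _∙_ e (g ∘ h)
foldr-map-tabulate {n = zero} _∙_ e g h = refl
foldr-map-tabulate {n = suc n} _∙_ e g h = cong (g (h zero) ∙_) (foldr-map-tabulate _∙_ e g (h ∘ suc))

ind : Bool → ℕ
ind b = if b then 1 else 0

count : ∀ {n} → (Fin n → Bool) → ℕ
count p = sum (ind ∘ p)

card≡count : ∀ {n} (B : Fin n → Bool) → card B ≡ count B
card≡count B = foldr-map-tabulate _+_ 0 (ind ∘ B) id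

deg≡count : ∀ {n} (G : SimpleGraph n) v → deg G v ≡ count (adj G v)
deg≡count G v = foldr-map-tabulate _+_ 0 (ind ∘ adj G v) id

sum-mono : ∀ {n} {g h : Fin n → ℕ} → (∀ u → g u ≤ h u) → sum g ≤ sum h
sum-mono {zero} g≤h = z≤n
sum-mono {suc n} g≤h = NP.+-mono-≤ (g≤h zero) (sum-mono (g≤h ∘ suc))

count-cong : ∀ {n} {p q : Fin n → Bool} → p ≗ q → count p ≡ count q
count-cong p≗q = sum-cong-≗ (cong ind ∘ p≗q)

count-all : ∀ n → count {n} (λ _ → true) ≡ n
count-all zero = refl
count-all (suc n) = cong suc (count-all n)

count-none : ∀ {n} (p : Fin n → Bool) → (∀ u → p u ≡ false) → count p ≡ 0
count-none {zero} p none = refl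
count-none {suc n} p none rewrite none zero = count-none (p ∘ suc) (none ∘ suc)

count-mono : ∀ {n} (p q : Fin n → Bool) → (∀ u → p u ≡ true → q u ≡ true) → count p ≤ count q
count-mono p q p⊆q = sum-mono (λ u → pointwise (p u) (q u) (p⊆q u))
  where
  pointwise : ∀ x y → (x ≡ true → y ≡ true) → ind x ≤ ind y
  pointwise true y x⇒y rewrite x⇒y refl = NP.≤-refl
  pointwise false y _ = z≤n

count-split : ∀ {n} (a b : Fin n → Bool) →
  count (λ u → a u ∧ b u) + count (λ u → a u ∧ not (b u)) ≡ count a
count-split a b = trans (≡-sym (∑-distrib-+ (λ u → ind (a u ∧ b u)) (λ u → ind (a u ∧ not (b u)))))
  (sum-cong-≗ (λ u → pointwise (a u) (b u)))
  where
  pointwise : ∀ x y → ind (x ∧ y) + ind (x ∧ not y) ≡ ind x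
  pointwise true true = refl
  pointwise true false = refl
  pointwise false y = refl

count-disjoint-∨ : ∀ {n} (a c : Fin n → Bool) → (∀ u → a u ∧ c u ≡ false) →
  count (λ u → a u ∨ c u) ≡ count a + count c
count-disjoint-∨ a c disjoint =
  trans (sum-cong-≗ (λ u → pointwise (a u) (c u) (disjoint u))) (∑-distrib-+ (ind ∘ a) (ind ∘ c))
  where
  pointwise : ∀ x y → x ∧ y ≡ false → ind (x ∨ y) ≡ ind x + ind y
  pointwise true true ()
  pointwise true false _ = refl
  pointwise false y _ = refl

count-∧-∨ : ∀ {n} (a b c : Fin n → Bool) →
  count (λ u → a u ∧ (b u ∨ c u)) ≤ count (λ u → a u ∧ b u) + count c
count-∧-∨ a b c = subst (count (λ u → a u ∧ (b u ∨ c u)) ≤_) (∑-distrib-+ (λ u → ind (a u ∧ b u)) (ind ∘ c))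
  (sum-mono (λ u → pointwise (a u) (b u) (c u)))
  where
  pointwise : ∀ x y z → ind (x ∧ (y ∨ z)) ≤ ind (x ∧ y) + ind z
  pointwise true true z = s≤s z≤n
  pointwise true false true = s≤s z≤n
  pointwise true false false = z≤n
  pointwise false y z = z≤n

count-positive : ∀ {n} (p : Fin n → Bool) {u} → p u ≡ true → 1 ≤ count p
count-positive p {zero} pu rewrite pu = s≤s z≤n
count-positive p {suc u} pu = NP.≤-trans (count-positive (p ∘ suc) pu) (NP.m≤n+m _ (ind (p zero)))

count≤1 : ∀ {n} (p : Fin n → Bool) → (∀ u v → p u ≡ true → p v ≡ true → u ≡ v) → count p ≤ 1
count≤1 {zero} p unique = z≤n
count≤1 {suc n} p unique with p zero in p0
... | true = subst (λ k → suc k ≤ 1) (≡-sym (count-none (p ∘ suc) rest-empty)) NP.≤-refl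
  where
  rest-empty : ∀ u → p (suc u) ≡ false
  rest-empty u with p (suc u) in pu
  ... | true with unique zero (suc u) p0 pu
  ...   | ()
  rest-empty u | false = refl
... | false = count≤1 (p ∘ suc) (λ u v pu pv → suc-injective (unique (suc u) (suc v) pu pv))

count≤1⇒unique : ∀ {n} (p : Fin n → Bool) → count p ≤ 1 → ∀ {u v} → p u ≡ true → p v ≡ true → u ≡ v
count≤1⇒unique p c {zero} {zero} pu pv = refl
count≤1⇒unique p c {zero} {suc v} pu pv rewrite pu with count-positive (p ∘ suc) pv | c
... | 1≤rest | s≤s rest≤0 = ⊥-elim (NP.<⇒≱ 1≤rest rest≤0)
count≤1⇒unique p c {suc u} {zero} pu pv = ≡-sym (count≤1⇒unique p c pv pu)
count≤1⇒unique p c {suc u} {suc v} pu pv =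
  cong suc (count≤1⇒unique (p ∘ suc) (NP.≤-trans (NP.m≤n+m _ (ind (p zero))) c) pu pv)

subset-of-size : ∀ {n} (c : Fin n → Bool) s → s ≤ count c →
  Σ (Fin n → Bool) (λ S → (∀ u → S u ≡ true → c u ≡ true) × count S ≡ s)
subset-of-size {zero} c .0 z≤n = (λ ()) , (λ ()) , refl
subset-of-size {suc n} c zero _ = (λ _ → false) , (λ _ ()) , count-none {suc n} (λ _ → false) (λ _ → refl)
subset-of-size {suc n} c (suc s) s<c with c zero in c0
... | true with subset-of-size (c ∘ suc) s (NP.≤-pred s<c)
...   | S , S⊆c , |S| = (λ { zero → true ; (suc u) → S u }) ,
                        (λ { zero _ → c0 ; (suc u) → S⊆c u }) , cong suc |S|
subset-of-size {suc n} c (suc s) s<c | false with subset-of-size (c ∘ suc) (suc s) s<c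
...   | S , S⊆c , |S| = (λ { zero → false ; (suc u) → S u }) ,
                        (λ { zero () ; (suc u) → S⊆c u }) , |S|

signed-count : ∀ {n} (a f : Fin n → Bool) →
  ΣℤV (λ u → if a u then sgn (f u) else + 0) ≡
  + count (λ u → a u ∧ f u) -ℤ + count (λ u → a u ∧ not (f u))
signed-count a f =
  trans (foldr-map-tabulate _+ℤ_ (+ 0) (λ u → if a u then sgn (f u) else + 0) id) (by-induction a f)
  where
  open +-*-Solver
  step : ∀ x y P N → (if x then sgn y else + 0) +ℤ (+ P -ℤ + N) ≡
    + (ind (x ∧ y) + P) -ℤ + (ind (x ∧ not y) + N)
  step true true P N = solve 2 (λ P N → con (+ 1) :+ (P :- N) := (con (+ 1) :+ P) :- N) refl (+ P) (+ N)
  step true false P N = solve 2 (λ P N → con (- + 1) :+ (P :- N) := P :- (con (+ 1) :+ N)) refl (+ P) (+ N)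
  step false y P N = ZP.+-identityˡ _
  by-induction : ∀ {n} (a f : Fin n → Bool) →
    Vector.foldr _+ℤ_ (+ 0) (λ u → if a u then sgn (f u) else + 0) ≡
    + count (λ u → a u ∧ f u) -ℤ + count (λ u → a u ∧ not (f u))
  by-induction {zero} a f = refl
  by-induction {suc n} a f =
    trans (cong ((if a zero then sgn (f zero) else + 0) +ℤ_) (by-induction (a ∘ suc) (f ∘ suc)))
          (step (a zero) (f zero) _ _)

weight-count : ∀ {n} (f : Fin n → Bool) → weight f ≡ + n -ℤ + (2 * count (not ∘ f))
weight-count {n} f = begin
  weight f                ≡⟨ signed-count (λ _ → true) f ⟩
  + P -ℤ + N              ≡⟨ solve 2 (λ P N → P :- N := (P :+ N) :- (N :+ (N :+ con (+ 0)))) refl (+ P) (+ N) ⟩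
  + (P + N) -ℤ + (2 * N)  ≡⟨ cong (λ m → + m -ℤ + (2 * N)) (trans (count-split (λ _ → true) f) (count-all n)) ⟩
  + n -ℤ + (2 * N)        ∎
  where
  open ≡-Reasoning
  open +-*-Solver
  P N : ℕ
  P = count f
  N = count (not ∘ f)

<⇒1≤difference : ∀ {P N} → N < P → + 1 ≤ℤ + P -ℤ + N
<⇒1≤difference {P} {N} N<P rewrite ZP.[+m]-[+n]≡m⊖n P N | ZP.⊖-≥ (NP.<⇒≤ N<P) =
  Z.+≤+ (NP.m<n⇒0<n∸m N<P)

1≤difference⇒< : ∀ {P N} → + 1 ≤ℤ + P -ℤ + N → N < P
1≤difference⇒< {P} {N} 1≤P-N with N NP.<? P
... | yes N<P = N<P
... | no N≮P rewrite ZP.[+m]-[+n]≡m⊖n P N | ZP.⊖-≤ (NP.≮⇒≥ N≮P) =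
  ⊥-elim (ZP.<-irrefl refl (ZP.<-≤-trans (Z.+<+ (s≤s z≤n)) (ZP.≤-trans 1≤P-N ZP.neg-≤-pos)))

bound-antitone : ∀ n {c ρ} → c ≤ ρ → + n -ℤ + (2 * ρ) ≤ℤ + n -ℤ + (2 * c)
bound-antitone n c≤ρ = ZP.+-monoʳ-≤ (+ n) (ZP.neg-mono-≤ (Z.+≤+ (NP.*-monoʳ-≤ 2 c≤ρ)))

∧-true : ∀ {x y} → x ∧ y ≡ true → x ≡ true × y ≡ true
∧-true {true} {true} _ = refl , refl

packing-neighbours≤1 : ∀ {n} (G : SimpleGraph n) (B : Fin n → Bool) → IsOpenPacking G B →
  ∀ v → count (λ u → adj G v u ∧ B u) ≤ 1
packing-neighbours≤1 G B packing v = count≤1 _ unique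
  where
  unique : ∀ u u' → adj G v u ∧ B u ≡ true → adj G v u' ∧ B u' ≡ true → u ≡ u'
  unique u u' vu∧Bu vu'∧Bu' with u ≟ u' | ∧-true vu∧Bu | ∧-true vu'∧Bu'
  ... | yes u≡u' | _ | _ = u≡u'
  ... | no u≢u' | vu , Bu | vu' , Bu' =
    ⊥-elim (packing u u' Bu Bu' u≢u' v (trans (sym G u v) vu , trans (sym G u' v) vu'))

packing-complement-large : ∀ {n} (G : SimpleGraph n) (B : Fin n → Bool) → IsOpenPacking G B →
  ∀ w → deg G w ≤ suc (count (not ∘ B))
packing-complement-large G B packing w = begin
  deg G w                             ≡⟨ deg≡count G w ⟩
  count (adj G w)                     ≡⟨ count-split (adj G w) B ⟨
  count (λ u → adj G w u ∧ B u) + count outside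
                                      ≤⟨ NP.+-mono-≤ (packing-neighbours≤1 G B packing w)
                                           (count-mono outside (not ∘ B) (λ u → proj₂ ∘ ∧-true)) ⟩
  suc (count (not ∘ B))               ∎
  where
  open NP.≤-Reasoning
  outside : Fin _ → Bool
  outside u = adj G w u ∧ not (B u)

minority : ∀ {P N k} → N ≤ k → suc (2 * k) ≤ P + N → N < P
minority {P} {N} {k} N≤k 2k<P+N = NP.+-cancelʳ-≤ N (suc N) P (begin
  suc (N + N)  ≤⟨ s≤s (NP.+-mono-≤ N≤k N≤k) ⟩
  suc (k + k)  ≡⟨ cong (λ m → suc (k + m)) (NP.+-identityʳ k) ⟨
  suc (2 * k)  ≤⟨ 2k<P+N ⟩
  P + N        ∎)
  where open NP.≤-Reasoning

small-minority : ∀ {P N} → N < P → P + N ≤ 4 → N ≤ 1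
small-minority {N = zero} _ _ = z≤n
small-minority {N = suc zero} _ _ = NP.≤-refl
small-minority {P} {N = suc (suc N)} N<P P+N≤4 with NP.≤-trans (NP.+-monoˡ-≤ (suc (suc N)) N<P) P+N≤4
... | s≤s (s≤s (s≤s N+2+N≤1)) with NP.≤-trans (NP.m≤n+m (suc (suc N)) N) N+2+N≤1
...   | s≤s ()

few-negatives⇒STDF : ∀ {n} (G : SimpleGraph n) (f : Fin n → Bool) k →
  (∀ v → suc (2 * k) ≤ deg G v) → (∀ v → count (λ u → adj G v u ∧ not (f u)) ≤ k) → IsSTDF G f
few-negatives⇒STDF G f k deg≥ negatives≤ v =
  subst (+ 1 ≤ℤ_) (≡-sym (signed-count (adj G v) f))
    (<⇒1≤difference (minority (negatives≤ v)
      (subst (suc (2 * k) ≤_) (trans (deg≡count G v) (≡-sym (count-split (adj G v) f))) (deg≥ v))))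

-- Conversely, if every degree is at most 4, an STDF has at most one −1 in
-- each open neighbourhood; so its −1's form an open packing, as two of them
-- with a common neighbour w would be the same vertex.
STDF-negatives-packing : ∀ {n} (G : SimpleGraph n) (f : Fin n → Bool) →
  (∀ v → deg G v ≤ 4) → IsSTDF G f → IsOpenPacking G (not ∘ f)
STDF-negatives-packing G f deg≤4 stdf u v negu negv u≢v w (uw , vw) =
  u≢v (count≤1⇒unique (λ x → adj G w x ∧ not (f x)) (negatives≤1 w)
         (∧-intro (trans (sym G w u) uw) negu) (∧-intro (trans (sym G w v) vw) negv))
  where
  ∧-intro : ∀ {x y} → x ≡ true → y ≡ true → x ∧ y ≡ true
  ∧-intro refl refl = refl
  negatives≤1 : ∀ w → count (λ x → adj G w x ∧ not (f x)) ≤ 1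
  negatives≤1 w = small-minority
    (1≤difference⇒< (subst (+ 1 ≤ℤ_) (signed-count (adj G w) f) (stdf w)))
    (subst (_≤ 4) (trans (deg≡count G w) (≡-sym (count-split (adj G w) f))) (deg≤4 w))

STDF-weight-lower-bound : ∀ {n} (G : SimpleGraph n) ρ → (∀ v → deg G v ≤ 4) →
  IsOpenPackingNumber G ρ → ∀ f → IsSTDF G f → + n -ℤ + (2 * ρ) ≤ℤ weight f
STDF-weight-lower-bound {n} G ρ deg≤4 (_ , maximal) f stdf =
  subst (_ ≤ℤ_) (≡-sym (weight-count f))
    (bound-antitone n (subst (_≤ ρ) (card≡count (not ∘ f))
      (maximal (not ∘ f) (STDF-negatives-packing G f deg≤4 stdf))))

negative-on : ∀ {n} → (B S : Fin n → Bool) → Fin n → Bool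
negative-on B S u = not (B u ∨ S u)

-- For an open packing B it is an STDF once every degree is at least
-- 2(|S| + 1) + 1: each neighbourhood meets B at most once and S at most |S| times.
negative-on-STDF : ∀ {n} (G : SimpleGraph n) (B S : Fin n → Bool) → IsOpenPacking G B →
  (∀ v → suc (2 * suc (count S)) ≤ deg G v) → IsSTDF G (negative-on B S)
negative-on-STDF G B S packing deg≥ = few-negatives⇒STDF G (negative-on B S) (suc (count S)) deg≥ negatives≤
  where
  open NP.≤-Reasoning
  negatives≤ : ∀ v → count (λ u → adj G v u ∧ not (negative-on B S u)) ≤ suc (count S)
  negatives≤ v = begin
    count (λ u → adj G v u ∧ not (not (B u ∨ S u))) ≡⟨ count-cong (λ u → cong (adj G v u ∧_) (not-involutive (B u ∨ S u))) ⟩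
    count (λ u → adj G v u ∧ (B u ∨ S u))           ≤⟨ count-∧-∨ (adj G v) B S ⟩
    count (λ u → adj G v u ∧ B u) + count S         ≤⟨ NP.+-monoˡ-≤ (count S) (packing-neighbours≤1 G B packing v) ⟩
    suc (count S)                                   ∎

negative-on-weight : ∀ {n} (B S : Fin n → Bool) → (∀ u → B u ∧ S u ≡ false) →
  weight (negative-on B S) ≡ + n -ℤ + (2 * (count B + count S))
negative-on-weight {n} B S disjoint =
  trans (weight-count (negative-on B S))
    (cong (λ m → + n -ℤ + (2 * m))
      (trans (count-cong (λ u → not-involutive (B u ∨ S u))) (count-disjoint-∨ B S disjoint)))

disjoint-from-complement : ∀ {n} (B S : Fin n → Bool) → (∀ u → S u ≡ true → not (B u) ≡ true) →
  ∀ u → B u ∧ S u ≡ false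
disjoint-from-complement B S S⊆B̅ u = pointwise (B u) (S u) (S⊆B̅ u)
  where
  pointwise : ∀ b s → (s ≡ true → not b ≡ true) → b ∧ s ≡ false
  pointwise true true s⇒b̅ with s⇒b̅ refl
  ... | ()
  pointwise true false _ = refl
  pointwise false s _ = refl

half-excess : ∀ δ → 3 ≤ δ → suc (2 * suc ((δ ∸ 3) / 2)) ≤ δ
half-excess δ 3≤δ = begin
  suc (2 * suc s)  ≡⟨ NS.solve 1 (λ s → con 1 :+ con 2 :* (con 1 :+ s) := con 3 :+ s :* con 2) refl s ⟩
  3 + s * 2        ≤⟨ NP.+-monoʳ-≤ 3 (m/n*n≤m (δ ∸ 3) 2) ⟩
  3 + (δ ∸ 3)      ≡⟨ NP.m+[n∸m]≡n 3≤δ ⟩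
  δ                ∎
  where
  open NP.≤-Reasoning
  open NS
  s = (δ ∸ 3) / 2

floor-shift : ∀ ρ δ → 3 ≤ δ → (2 * ρ + δ ∸ 3) / 2 ≡ ρ + (δ ∸ 3) / 2
floor-shift ρ δ 3≤δ = begin
  (2 * ρ + δ ∸ 3) / 2          ≡⟨ /-congˡ (NP.+-∸-assoc (2 * ρ) 3≤δ) ⟩
  (2 * ρ + (δ ∸ 3)) / 2        ≡⟨ +-distrib-/-∣ˡ (δ ∸ 3) (divides ρ (NP.*-comm 2 ρ)) ⟩
  (2 * ρ) / 2 + (δ ∸ 3) / 2    ≡⟨ cong (_+ (δ ∸ 3) / 2) (trans (/-congˡ (NP.*-comm 2 ρ)) (m*n/n≡m ρ 2)) ⟩
  ρ + (δ ∸ 3) / 2              ∎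
  where open ≡-Reasoning

-- The first half of Theorem 2.1: a maximum open packing B together with
-- ⌊(δ − 3)/2⌋ further vertices carries the −1's of an STDF.
upper-bound : (n : ℕ) (G : SimpleGraph n) (δ ρ : ℕ) (γ : ℤ) →
  IsMinDegree G δ → 3 ≤ δ → IsOpenPackingNumber G ρ → IsSignedTotalDominationNumber G γ →
  γ ≤ℤ stBound n ρ δ
upper-bound n G δ ρ γ (δ≤deg , w , _) 3≤δ ((B , packing , |B|≡ρ) , _) (_ , γ-minimal) =
  subst (γ ≤ℤ_) weight≡bound (γ-minimal (negative-on B S) (negative-on-STDF G B S packing degrees))
  where
  s : ℕ
  s = (δ ∸ 3) / 2
  -- a vertex w of minimum degree has at least s neighbours outside B
  room : s ≤ count (not ∘ B)
  room = NP.≤-pred (begin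
    suc s                  ≤⟨ s≤s (NP.≤-trans (NP.n≤1+n s) (NP.m≤n*m (suc s) 2)) ⟩
    suc (2 * suc s)        ≤⟨ half-excess δ 3≤δ ⟩
    δ                      ≤⟨ δ≤deg w ⟩
    deg G w                ≤⟨ packing-complement-large G B packing w ⟩
    suc (count (not ∘ B))  ∎)
    where open NP.≤-Reasoning
  chosen : Σ (Fin n → Bool) (λ S → (∀ u → S u ≡ true → not (B u) ≡ true) × count S ≡ s)
  chosen = subset-of-size (not ∘ B) s room
  S : Fin n → Bool
  S = proj₁ chosen
  |S|≡s : count S ≡ s
  |S|≡s = proj₂ (proj₂ chosen)
  degrees : ∀ v → suc (2 * suc (count S)) ≤ deg G v
  degrees v = subst (λ k → suc (2 * suc k) ≤ deg G v) (≡-sym |S|≡s) (NP.≤-trans (half-excess δ 3≤δ) (δ≤deg v))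
  weight≡bound : weight (negative-on B S) ≡ stBound n ρ δ
  weight≡bound = begin
    weight (negative-on B S)            ≡⟨ negative-on-weight B S (disjoint-from-complement B S (proj₁ (proj₂ chosen))) ⟩
    n-twice (count B + count S)         ≡⟨ cong n-twice (cong₂ _+_ (trans (≡-sym (card≡count B)) |B|≡ρ) |S|≡s) ⟩
    n-twice (ρ + s)                     ≡⟨ cong n-twice (floor-shift ρ δ 3≤δ) ⟨
    stBound n ρ δ                       ∎
    where
    open ≡-Reasoning
    n-twice : ℕ → ℤ
    n-twice m = + n -ℤ + (2 * m)

complete : ∀ n → SimpleGraph n
complete n = record
  { adj    = λ u v → not (does (u ≟ v))
  ; sym    = λ u v → cong not (does-⇔ (mk⇔ ≡-sym ≡-sym) (u ≟ v) (v ≟ u))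
  ; irrefl = λ v → cong not (dec-true (v ≟ v) refl)
  }

K₄ : SimpleGraph 4
K₄ = complete 4

K₄-cubic : ∀ v → deg K₄ v ≡ 3
K₄-cubic zero = refl
K₄-cubic (suc zero) = refl
K₄-cubic (suc (suc zero)) = refl
K₄-cubic (suc (suc (suc zero))) = refl

K₄-common-neighbour : ∀ u v → ∃ λ w → adj K₄ u w ≡ true × adj K₄ v w ≡ true
K₄-common-neighbour = toWitness {a? = all? λ u → all? λ v → any? λ w →
  (adj K₄ u w Bool.≟ true) ×-dec (adj K₄ v w Bool.≟ true)} _

common-neighbours⇒packing≤1 : ∀ {n} (G : SimpleGraph n) →
  (∀ u v → ∃ λ w → adj G u w ≡ true × adj G v w ≡ true) →
  ∀ B → IsOpenPacking G B → card B ≤ 1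
common-neighbours⇒packing≤1 G common B packing =
  subst (_≤ 1) (≡-sym (card≡count B)) (count≤1 B unique)
  where
  unique : ∀ u v → B u ≡ true → B v ≡ true → u ≡ v
  unique u v Bu Bv with u ≟ v
  ... | yes u≡v = u≡v
  ... | no u≢v = ⊥-elim (packing u v Bu Bv u≢v (proj₁ (common u v)) (proj₂ (common u v)))

K₄-open-packing-number : IsOpenPackingNumber K₄ 1
K₄-open-packing-number = (only-zero , packing , refl) , common-neighbours⇒packing≤1 K₄ K₄-common-neighbour
  where
  only-zero : Fin 4 → Bool
  only-zero zero = true
  only-zero (suc _) = false
  packing : IsOpenPacking K₄ only-zero
  packing zero zero _ _ 0≢0 = ⊥-elim (0≢0 refl)

-- The labelling with a single −1 is an STDF of weight 2, and by the lower
-- bound n − 2ρ_o for graphs of maximum degree ≤ 4 it is optimal.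
K₄-signed-total-domination-number : IsSignedTotalDominationNumber K₄ (+ 2)
K₄-signed-total-domination-number =
  (one-negative , stdf , refl) ,
  STDF-weight-lower-bound K₄ 1 (λ v → NP.≤-trans (NP.≤-reflexive (K₄-cubic v)) (NP.n≤1+n 3)) K₄-open-packing-number
  where
  one-negative : Fin 4 → Bool
  one-negative zero = false
  one-negative (suc _) = true
  stdf : IsSTDF K₄ one-negative
  stdf zero = Z.+≤+ (s≤s z≤n)
  stdf (suc zero) = Z.+≤+ (s≤s z≤n)
  stdf (suc (suc zero)) = Z.+≤+ (s≤s z≤n)
  stdf (suc (suc (suc zero))) = Z.+≤+ (s≤s z≤n)

theorem2p1 : ((n : ℕ) (G : SimpleGraph n) (δ ρ : ℕ) (γ : ℤ) →
    IsMinDegree G δ → 3 ≤ δ →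
    IsOpenPackingNumber G ρ → IsSignedTotalDominationNumber G γ →
    γ ≤ℤ stBound n ρ δ)
    ×
    Σ ℕ (λ n → Σ (SimpleGraph n) (λ G → Σ ℕ (λ δ → Σ ℕ (λ ρ → Σ ℤ (λ γ →
    IsMinDegree G δ × 3 ≤ δ ×
    IsOpenPackingNumber G ρ × IsSignedTotalDominationNumber G γ ×
    γ ≡ stBound n ρ δ)))))
-- The bound holds in general, and K₄ (n = 4, δ = 3, ρ_o = 1, γ_st = 2) attains it.
theorem2p1 = upper-bound ,
  (4 , K₄ , 3 , 1 , + 2 ,
   ((λ v → NP.≤-reflexive (≡-sym (K₄-cubic v))) , zero , K₄-cubic zero) ,
   s≤s (s≤s (s≤s z≤n)) ,
   K₄-open-packing-number ,
   K₄-signed-total-domination-number ,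
   refl)
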